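{- For integers $n\geq1$ and $0\leq k\leq n$, \[ \frac{q^k+q^{n-k}}{1+q^n}\binom{n}{k}_{q^2}=q^{n-k}\binom{n-1}{k-1}_{q^2}+q^k\binom{n-1}{k}_{q^2}\in\mathbb{Z}_{\geq0}[q], \] and this common value equals the deformed $q$-binomial $\left[\!\left[\begin{smallmatrix}n\\k\end{smallmatrix}\right]\!\right]_{q;2}$ (the case $m=d=2$, $\alpha=(k,n-k)$).
   Context: $\binom{a}{b}_q=\frac{[a]_q!}{[b]_q![a-b]_q!}$ with $[j]_q=1+q+\dots+q^{j-1}$, $[a]_q!=[a]_q\cdots[1]_q$, and $\binom{a}{b}_q=0$ if $b<0$ or $b>a$. For a weak composition $\alpha=(\alpha_1,\dots,\alpha_m)$ of $n$ and $d\mid m$, let $\sigma_m\cdot\alpha=(\alpha_m,\alpha_1,\dots,\alpha_{m-1})$, $\tau=\sigma_m^{m/d}$, $C_d=\langle\tau\rangle$, $b(\alpha)=\sum_i(i-1)\alpha_i$, and $\left[\!\left[\begin{smallmatrix}n\\\alpha\end{smallmatrix}\right]\!\right]_{q;d}=\frac{\sum_{\sigma\in C_d}q^{b(\sigma\cdot\alpha)}}{[d]_{q^{nm/d}}}\binom{n}{\alpha}_{q^m}$, where $\binom{n}{\alpha}_q=[n]_q!/\prod_i[\alpha_i]_q!$. $\left[\!\left[\begin{smallmatrix}n\\k\end{smallmatrix}\right]\!\right]_{q;2}$ denotes this with $m=d=2$, $\alpha=(k,n-k)$. -}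

module Defs where

open import Data.Nat using (ℕ; zero; suc; _+_; _*_; _∸_; NonZero)
open import Data.Nat.DivMod using (_/_)
open import Data.List using (List; []; _∷_; replicate; _++_; map; foldr)
open import Data.Vec as V using (Vec)
open import Data.Fin using (Fin; toℕ)
open import Relation.Binary.PropositionalEquality using (_≡_)

-- Polynomials in q with coefficients in ℕ (i.e. elements of ℤ≥0[q]),
-- as coefficient lists (constant term first).
Poly : Set
Poly = List ℕ

coeff : Poly → ℕ → ℕ
coeff [] i = 0
coeff (a ∷ p) zero = a
coeff (a ∷ p) (suc i) = coeff p i

-- equality of polynomials: equal coefficients (trailing zeros irrelevant)
infix 4 _≈ₚ_
_≈ₚ_ : Poly → Poly → Set
p ≈ₚ r = ∀ i → coeff p i ≡ coeff r i

infixl 6 _+ₚ_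
_+ₚ_ : Poly → Poly → Poly
[] +ₚ r = r
(a ∷ p) +ₚ [] = a ∷ p
(a ∷ p) +ₚ (b ∷ r) = (a + b) ∷ (p +ₚ r)

infixl 7 _*ₚ_
_*ₚ_ : Poly → Poly → Poly
[] *ₚ r = []
(a ∷ p) *ₚ r = map (a *_) r +ₚ (0 ∷ (p *ₚ r))

X^ : ℕ → Poly
X^ j = replicate j 0 ++ (1 ∷ [])

oneₚ : Poly
oneₚ = X^ 0

ΣP : ℕ → (ℕ → Poly) → Poly
ΣP zero f = []
ΣP (suc j) f = ΣP j f +ₚ f j

ΠP : ℕ → (ℕ → Poly) → Poly
ΠP zero f = oneₚ
ΠP (suc j) f = ΠP j f *ₚ f j

qint : ℕ → ℕ → Poly
qint m j = ΣP j (λ i → X^ (m * i))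

qfact : ℕ → ℕ → Poly
qfact m j = ΠP j (λ i → qint m (suc i))

-- Gaussian binomial  binom(a,b)_{q^m}  (zero if b > a), via the q-Pascal rule
-- binom(a+1,b+1) = binom(a,b) + Q^{b+1} binom(a,b+1),  Q = q^m.
qbinom : ℕ → ℕ → ℕ → Poly
qbinom m zero zero = oneₚ
qbinom m zero (suc b) = []
qbinom m (suc a) zero = oneₚ
qbinom m (suc a) (suc b) = qbinom m a b +ₚ X^ (m * suc b) *ₚ qbinom m a (suc b)

-- qbinom↓ m a k = binom(a, k-1)_{q^m}, which is 0 when k = 0 (lower index -1)
qbinom↓ : ℕ → ℕ → ℕ → Poly
qbinom↓ m a zero = []
qbinom↓ m a (suc k) = qbinom m a k

rot : ∀ {m} → Vec ℕ m → Vec ℕ m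
rot {zero} v = v
rot {suc m} v = V.last v V.∷ V.init v

rotN : ∀ {m} → ℕ → Vec ℕ m → Vec ℕ m
rotN zero v = v
rotN (suc j) v = rot (rotN j v)

-- b(α) = Σ_i (i-1) α_i   (with 0-based Fin index i-1)
bstat : ∀ {m} → Vec ℕ m → ℕ
bstat {m} α = V.sum (V.tabulate (λ (i : Fin m) → toℕ i * V.lookup α i))

qfactProd : ∀ {m} → ℕ → Vec ℕ m → Poly
qfactProd mm α = foldr (λ a acc → qfact mm a *ₚ acc) oneₚ (V.toList α)

-- P is the deformed multinomial [[n; α]]_{q;d}, i.e.
--   P = (Σ_{σ ∈ C_d} q^{b(σ·α)}) / [d]_{q^{nm/d}} · [n]_{q^m}! / Π_i [α_i]_{q^m}!
-- stated with denominators cleared (ℕ[q] is cancellative, so P is unique).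
-- C_d = ⟨τ⟩, τ = σ_m^{m/d}, has the d distinct elements τ^j, j < d.
IsDeformed : (n m d : ℕ) .{{_ : NonZero d}} → Vec ℕ m → Poly → Set
IsDeformed n m d α P =
  qint (n * m / d) d *ₚ P *ₚ qfactProd m α
    ≈ₚ ΣP d (λ j → X^ (bstat (rotN (j * (m / d)) α))) *ₚ qfact m n

module Submission where

-- Write Q = q².  The theorem has two parts.
--
-- (1) (1 + qⁿ)·R = (qᵏ + qⁿ⁻ᵏ)·binom(n,k)_Q  for
--     R = qⁿ⁻ᵏ·binom(n-1,k-1)_Q + qᵏ·binom(n-1,k)_Q.
--     For k = j+1, n = j+c+1 put u = q^{j+1}, v = q^c, x = binom(n-1,j)_Q,
--     y = binom(n-1,j+1)_Q.  Then (1 + uv)(v·x + u·y) = u(v²x + y) + v(x + u²y),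
--     and since u² = Q^{j+1}, v² = Q^c each bracket equals binom(n,k)_Q: the
--     second by the Pascal rule that defines qbinom, the first by the dual rule
--     binom(a+1,b+1) = Q^c binom(a,b) + binom(a,b+1)  (b + c = a).
--     The case k = 0 is immediate.
-- (2) The deformed binomial: for m = d = 2 its defining identity reads
--     (1 + qⁿ)·R·[k]!·[n-k]! = (qⁿ⁻ᵏ + qᵏ)·[n]!  (factorials in base Q), which
--     is (1) multiplied by the factorial formula binom(n,k)[k]![n-k]! = [n]!.

open import Defs
open import Data.Nat using (ℕ; zero; suc; _+_; _*_; _≤_; _<_; _∸_; s≤s)
open import Data.Nat.Properties
  using (+-identityʳ; +-assoc; +-comm; *-comm; *-assoc; *-zeroʳ; *-identityʳ;
         *-distribʳ-+; *-distribˡ-+; *-suc; +-suc; m+[n∸m]≡n; ≤-refl; ≤-reflexive; m≤n⇒m≤1+n)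
open import Data.Nat.DivMod using (_/_; m*n/n≡m)
open import Data.Product using (_×_; _,_)
open import Data.Vec using (_∷_; [])
open import Data.List using ([]; _∷_; map)
open import Function using (_∘_)
open import Relation.Binary.PropositionalEquality
  using (_≡_; _≗_; refl; sym; trans; cong; cong₂; module ≡-Reasoning)
open import Algebra.Bundles using (CommutativeSemiring)
import Algebra.Solver.Ring.NaturalCoefficients.Default as CommutativeSemiringSolver
open import Data.Nat.Solver using (module +-*-Solver)

Series : Set
Series = ℕ → ℕ

shift : Series → Series
shift f i = f (suc i)

infixl 7 _⋆_
_⋆_ : Series → Series → Series
(f ⋆ g) zero = f 0 * g 0
(f ⋆ g) (suc i) = f 0 * g (suc i) + (shift f ⋆ g) i

⋆-cong : ∀ {f f′ g g′} → f ≗ f′ → g ≗ g′ → f ⋆ g ≗ f′ ⋆ g′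
⋆-cong ef eg zero = cong₂ _*_ (ef 0) (eg 0)
⋆-cong ef eg (suc i) = cong₂ _+_ (cong₂ _*_ (ef 0) (eg (suc i))) (⋆-cong (ef ∘ suc) eg i)

⋆-zeroˡ : ∀ g → (λ _ → 0) ⋆ g ≗ (λ _ → 0)
⋆-zeroˡ g zero = refl
⋆-zeroˡ g (suc i) = ⋆-zeroˡ g i

⋆-distribʳ : ∀ f h g i → ((λ j → f j + h j) ⋆ g) i ≡ (f ⋆ g) i + (h ⋆ g) i
⋆-distribʳ f h g zero = *-distribʳ-+ (g 0) (f 0) (h 0)
⋆-distribʳ f h g (suc i) rewrite ⋆-distribʳ (shift f) (shift h) g i =
  solve 5 (λ a b c x y → (a :+ b) :* c :+ (x :+ y) := (a :* c :+ x) :+ (b :* c :+ y)) refl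
    (f 0) (h 0) (g (suc i)) ((shift f ⋆ g) i) ((shift h ⋆ g) i)
  where open +-*-Solver

⋆-scaleˡ : ∀ a f g i → ((λ j → a * f j) ⋆ g) i ≡ a * (f ⋆ g) i
⋆-scaleˡ a f g zero = *-assoc a (f 0) (g 0)
⋆-scaleˡ a f g (suc i) rewrite ⋆-scaleˡ a (shift f) g i =
  solve 4 (λ a b c x → a :* b :* c :+ a :* x := a :* (b :* c :+ x)) refl
    a (f 0) (g (suc i)) ((shift f ⋆ g) i)
  where open +-*-Solver

-- The Cauchy product can equally be unfolded from the right; this is the
-- mirror image that makes commutativity a plain induction.
⋆-sucʳ : ∀ f g i → (f ⋆ g) (suc i) ≡ (f ⋆ shift g) i + f (suc i) * g 0
⋆-sucʳ f g zero = refl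
⋆-sucʳ f g (suc i) =
  trans (cong (f 0 * g (suc (suc i)) +_) (⋆-sucʳ (shift f) g i)) (sym (+-assoc (f 0 * g (suc (suc i))) ((shift f ⋆ shift g) i) (f (suc (suc i)) * g 0)))

⋆-comm : ∀ f g → f ⋆ g ≗ g ⋆ f
⋆-comm f g zero = *-comm (f 0) (g 0)
⋆-comm f g (suc i) = begin
  f 0 * g (suc i) + (shift f ⋆ g) i  ≡⟨ cong₂ _+_ (*-comm (f 0) (g (suc i))) (⋆-comm (shift f) g i) ⟩
  g (suc i) * f 0 + (g ⋆ shift f) i  ≡⟨ +-comm (g (suc i) * f 0) ((g ⋆ shift f) i) ⟩
  (g ⋆ shift f) i + g (suc i) * f 0  ≡⟨ sym (⋆-sucʳ g f i) ⟩
  (g ⋆ f) (suc i)                    ∎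
  where open ≡-Reasoning

⋆-assoc : ∀ f g h → (f ⋆ g) ⋆ h ≗ f ⋆ (g ⋆ h)
⋆-assoc f g h zero = *-assoc (f 0) (g 0) (h 0)
⋆-assoc f g h (suc i) = begin
  f 0 * g 0 * h (suc i) + ((λ j → f 0 * g (suc j) + (shift f ⋆ g) j) ⋆ h) i
    ≡⟨ cong (f 0 * g 0 * h (suc i) +_) (⋆-distribʳ (λ j → f 0 * g (suc j)) (shift f ⋆ g) h i) ⟩
  f 0 * g 0 * h (suc i) + (((λ j → f 0 * g (suc j)) ⋆ h) i + ((shift f ⋆ g) ⋆ h) i)
    ≡⟨ cong (λ t → f 0 * g 0 * h (suc i) + t)
         (cong₂ _+_ (⋆-scaleˡ (f 0) (shift g) h i) (⋆-assoc (shift f) g h i)) ⟩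
  f 0 * g 0 * h (suc i) + (f 0 * (shift g ⋆ h) i + (shift f ⋆ (g ⋆ h)) i)
    ≡⟨ solve 5 (λ a b c x y → a :* b :* c :+ (a :* x :+ y) := a :* (b :* c :+ x) :+ y) refl
         (f 0) (g 0) (h (suc i)) ((shift g ⋆ h) i) ((shift f ⋆ (g ⋆ h)) i) ⟩
  f 0 * (g 0 * h (suc i) + (shift g ⋆ h) i) + (shift f ⋆ (g ⋆ h)) i
    ∎
  where open ≡-Reasoning
        open +-*-Solver

coeff-+ : ∀ p r → coeff (p +ₚ r) ≗ (λ i → coeff p i + coeff r i)
coeff-+ [] r i = refl
coeff-+ (a ∷ p) [] i = sym (+-identityʳ _)
coeff-+ (a ∷ p) (b ∷ r) zero = refl
coeff-+ (a ∷ p) (b ∷ r) (suc i) = coeff-+ p r i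

coeff-map : ∀ a r → coeff (map (a *_) r) ≗ (λ i → a * coeff r i)
coeff-map a [] i = sym (*-zeroʳ a)
coeff-map a (b ∷ r) zero = refl
coeff-map a (b ∷ r) (suc i) = coeff-map a r i

coeff-* : ∀ p r → coeff (p *ₚ r) ≗ coeff p ⋆ coeff r
coeff-* [] r i = sym (⋆-zeroˡ (coeff r) i)
coeff-* (a ∷ p) r zero =
  trans (coeff-+ (map (a *_) r) (0 ∷ (p *ₚ r)) 0) (trans (+-identityʳ _) (coeff-map a r 0))
coeff-* (a ∷ p) r (suc i) =
  trans (coeff-+ (map (a *_) r) (0 ∷ (p *ₚ r)) (suc i))
        (cong₂ _+_ (coeff-map a r (suc i)) (coeff-* p r i))

-- Polynomial equality _≈ₚ_ wrapped in a record: the record type former is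
-- injective, so Agda can infer both sides of an equation from its type, which
-- the solver and setoid reasoning below rely on.
infix 4 _≋_
record _≋_ (p r : Poly) : Set where
  constructor mk
  field un : p ≈ₚ r
open _≋_

≋-refl : ∀ {p} → p ≋ p
≋-refl = mk λ _ → refl

≋-sym : ∀ {p r} → p ≋ r → r ≋ p
≋-sym (mk e) = mk (sym ∘ e)

≋-trans : ∀ {p r s} → p ≋ r → r ≋ s → p ≋ s
≋-trans (mk e) (mk f) = mk λ i → trans (e i) (f i)

≡⇒≋ : ∀ {p r} → p ≡ r → p ≋ r
≡⇒≋ refl = ≋-refl

-- Every semiring law for polynomials is the corresponding law for ℕ (for +ₚ)
-- or for the Cauchy product (for *ₚ), transported along coeff-+ / coeff-*.

+ₚ-cong : ∀ {p p′ r r′} → p ≋ p′ → r ≋ r′ → p +ₚ r ≋ p′ +ₚ r′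
+ₚ-cong {p} {p′} {r} {r′} (mk e) (mk f) =
  mk λ i → trans (coeff-+ p r i) (trans (cong₂ _+_ (e i) (f i)) (sym (coeff-+ p′ r′ i)))

+ₚ-assoc : ∀ p r s → (p +ₚ r) +ₚ s ≋ p +ₚ (r +ₚ s)
+ₚ-assoc p r s = mk λ i → begin
  coeff ((p +ₚ r) +ₚ s) i           ≡⟨ coeff-+ (p +ₚ r) s i ⟩
  coeff (p +ₚ r) i + coeff s i      ≡⟨ cong (_+ coeff s i) (coeff-+ p r i) ⟩
  coeff p i + coeff r i + coeff s i ≡⟨ +-assoc (coeff p i) (coeff r i) (coeff s i) ⟩
  coeff p i + (coeff r i + coeff s i) ≡⟨ cong (coeff p i +_) (sym (coeff-+ r s i)) ⟩
  coeff p i + coeff (r +ₚ s) i      ≡⟨ sym (coeff-+ p (r +ₚ s) i) ⟩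
  coeff (p +ₚ (r +ₚ s)) i           ∎
  where open ≡-Reasoning

+ₚ-comm : ∀ p r → p +ₚ r ≋ r +ₚ p
+ₚ-comm p r =
  mk λ i → trans (coeff-+ p r i) (trans (+-comm (coeff p i) (coeff r i)) (sym (coeff-+ r p i)))

+ₚ-identityʳ : ∀ p → p +ₚ [] ≋ p
+ₚ-identityʳ p = mk λ i → trans (coeff-+ p [] i) (+-identityʳ _)

*ₚ-cong : ∀ {p p′ r r′} → p ≋ p′ → r ≋ r′ → p *ₚ r ≋ p′ *ₚ r′
*ₚ-cong {p} {p′} {r} {r′} (mk e) (mk f) =
  mk λ i → trans (coeff-* p r i) (trans (⋆-cong e f i) (sym (coeff-* p′ r′ i)))

*ₚ-assoc : ∀ p r s → (p *ₚ r) *ₚ s ≋ p *ₚ (r *ₚ s)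
*ₚ-assoc p r s = mk λ i → begin
  coeff ((p *ₚ r) *ₚ s) i          ≡⟨ coeff-* (p *ₚ r) s i ⟩
  (coeff (p *ₚ r) ⋆ coeff s) i     ≡⟨ ⋆-cong (coeff-* p r) (λ _ → refl) i ⟩
  (coeff p ⋆ coeff r ⋆ coeff s) i  ≡⟨ ⋆-assoc (coeff p) (coeff r) (coeff s) i ⟩
  (coeff p ⋆ (coeff r ⋆ coeff s)) i ≡⟨ ⋆-cong (λ _ → refl) (sym ∘ coeff-* r s) i ⟩
  (coeff p ⋆ coeff (r *ₚ s)) i     ≡⟨ sym (coeff-* p (r *ₚ s) i) ⟩
  coeff (p *ₚ (r *ₚ s)) i          ∎
  where open ≡-Reasoning

*ₚ-comm : ∀ p r → p *ₚ r ≋ r *ₚ p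
*ₚ-comm p r =
  mk λ i → trans (coeff-* p r i) (trans (⋆-comm (coeff p) (coeff r) i) (sym (coeff-* r p i)))

*ₚ-identityˡ : ∀ p → oneₚ *ₚ p ≋ p
*ₚ-identityˡ p = mk coeffs
  where
    coeffs : ∀ i → coeff (oneₚ *ₚ p) i ≡ coeff p i
    coeffs zero = trans (coeff-* oneₚ p 0) (+-identityʳ _)
    coeffs (suc i) = trans (coeff-* oneₚ p (suc i))
      (trans (cong (coeff p (suc i) + 0 +_) (⋆-zeroˡ (coeff p) i))
             (trans (+-identityʳ _) (+-identityʳ _)))

*ₚ-distribʳ : ∀ p r s → (r +ₚ s) *ₚ p ≋ r *ₚ p +ₚ s *ₚ p
*ₚ-distribʳ p r s = mk λ i → begin
  coeff ((r +ₚ s) *ₚ p) i               ≡⟨ coeff-* (r +ₚ s) p i ⟩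
  (coeff (r +ₚ s) ⋆ coeff p) i          ≡⟨ ⋆-cong (coeff-+ r s) (λ _ → refl) i ⟩
  ((λ j → coeff r j + coeff s j) ⋆ coeff p) i ≡⟨ ⋆-distribʳ (coeff r) (coeff s) (coeff p) i ⟩
  (coeff r ⋆ coeff p) i + (coeff s ⋆ coeff p) i
    ≡⟨ cong₂ _+_ (sym (coeff-* r p i)) (sym (coeff-* s p i)) ⟩
  coeff (r *ₚ p) i + coeff (s *ₚ p) i   ≡⟨ sym (coeff-+ (r *ₚ p) (s *ₚ p) i) ⟩
  coeff (r *ₚ p +ₚ s *ₚ p) i            ∎
  where open ≡-Reasoning

*ₚ-distribˡ : ∀ p r s → p *ₚ (r +ₚ s) ≋ p *ₚ r +ₚ p *ₚ s
*ₚ-distribˡ p r s =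
  ≋-trans (*ₚ-comm p (r +ₚ s))
    (≋-trans (*ₚ-distribʳ p r s) (+ₚ-cong (*ₚ-comm r p) (*ₚ-comm s p)))

*ₚ-zeroʳ : ∀ p → p *ₚ [] ≋ []
*ₚ-zeroʳ p = *ₚ-comm p []

+ₚ-congˡ : ∀ p {r r′} → r ≋ r′ → p +ₚ r ≋ p +ₚ r′
+ₚ-congˡ p = +ₚ-cong (≋-refl {p})

+ₚ-congʳ : ∀ r {p p′} → p ≋ p′ → p +ₚ r ≋ p′ +ₚ r
+ₚ-congʳ r e = +ₚ-cong e (≋-refl {r})

*ₚ-congˡ : ∀ p {r r′} → r ≋ r′ → p *ₚ r ≋ p *ₚ r′
*ₚ-congˡ p = *ₚ-cong (≋-refl {p})

*ₚ-congʳ : ∀ r {p p′} → p ≋ p′ → p *ₚ r ≋ p′ *ₚ r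
*ₚ-congʳ r e = *ₚ-cong e (≋-refl {r})

polySemiring : CommutativeSemiring _ _
polySemiring = record
  { Carrier = Poly ; _≈_ = _≋_ ; _+_ = _+ₚ_ ; _*_ = _*ₚ_ ; 0# = [] ; 1# = oneₚ
  ; isCommutativeSemiring = record
    { isSemiring = record
      { isSemiringWithoutAnnihilatingZero = record
        { +-isCommutativeMonoid = record
          { isMonoid = record
            { isSemigroup = record
              { isMagma = record
                { isEquivalence = record { refl = ≋-refl ; sym = ≋-sym ; trans = ≋-trans }
                ; ∙-cong = +ₚ-cong }
              ; assoc = +ₚ-assoc }
            ; identity = (λ _ → ≋-refl) , +ₚ-identityʳ }
          ; comm = +ₚ-comm }
        ; *-cong = *ₚ-cong
        ; *-assoc = *ₚ-assoc
        ; *-identity = *ₚ-identityˡ , (λ p → ≋-trans (*ₚ-comm p oneₚ) (*ₚ-identityˡ p))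
        ; distrib = *ₚ-distribˡ , *ₚ-distribʳ }
      ; zero = (λ _ → ≋-refl) , *ₚ-zeroʳ }
    ; *-comm = *ₚ-comm } }

open CommutativeSemiringSolver polySemiring
  using (con) renaming (solve to psolve; _:+_ to _⊕_; _:*_ to _⊗_; _:=_ to _==_)
open import Relation.Binary.Reasoning.Setoid (CommutativeSemiring.setoid polySemiring)

X^-cong : ∀ {a b} → a ≡ b → X^ a ≋ X^ b
X^-cong e = ≡⇒≋ (cong X^ e)

X^-suc-* : ∀ a r → X^ (suc a) *ₚ r ≋ 0 ∷ (X^ a *ₚ r)
X^-suc-* a r = mk λ i → trans (coeff-+ (map (0 *_) r) (0 ∷ (X^ a *ₚ r)) i)
  (cong (_+ coeff (0 ∷ (X^ a *ₚ r)) i) (coeff-map 0 r i))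

X^-+ : ∀ a b → X^ (a + b) ≋ X^ a *ₚ X^ b
X^-+ zero b = ≋-sym (*ₚ-identityˡ (X^ b))
X^-+ (suc a) b = ≋-trans (mk λ { zero → refl ; (suc i) → un (X^-+ a b) i }) (≋-sym (X^-suc-* a (X^ b)))

qbinom-zero : ∀ m a → qbinom m a 0 ≡ oneₚ
qbinom-zero m zero = refl
qbinom-zero m (suc a) = refl

qbinom-above : ∀ m a b → a < b → qbinom m a b ≋ []
qbinom-above m zero (suc b) _ = ≋-refl
qbinom-above m (suc a) (suc b) (s≤s a<b) = begin
  qbinom m a b +ₚ X^ (m * suc b) *ₚ qbinom m a (suc b)
    ≈⟨ +ₚ-cong (qbinom-above m a b a<b)
               (*ₚ-congˡ (X^ (m * suc b)) (qbinom-above m a (suc b) (m≤n⇒m≤1+n a<b))) ⟩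
  [] +ₚ X^ (m * suc b) *ₚ []
    ≈⟨ *ₚ-zeroʳ (X^ (m * suc b)) ⟩
  [] ∎

qbinom-diag : ∀ m a → qbinom m a a ≋ oneₚ
qbinom-diag m zero = ≋-refl
qbinom-diag m (suc a) = begin
  qbinom m a a +ₚ X^ (m * suc a) *ₚ qbinom m a (suc a)
    ≈⟨ +ₚ-cong (qbinom-diag m a) (*ₚ-congˡ (X^ (m * suc a)) (qbinom-above m a (suc a) ≤-refl)) ⟩
  oneₚ +ₚ X^ (m * suc a) *ₚ []
    ≈⟨ psolve 1 (λ w → con 1 ⊕ w ⊗ con 0 == con 1) ≋-refl (X^ (m * suc a)) ⟩
  oneₚ ∎

-- The column b = 1:  1 + Q·binom(a,1) = Q^a + binom(a,1), i.e. the dual Pascal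
-- rule below in its base case b = 0.
qbinom-one : ∀ m a → oneₚ +ₚ X^ m *ₚ qbinom m a 1 ≋ X^ (m * a) +ₚ qbinom m a 1
qbinom-one m zero = begin
  oneₚ +ₚ X^ m *ₚ []       ≈⟨ psolve 1 (λ w → con 1 ⊕ w ⊗ con 0 == con 1 ⊕ con 0) ≋-refl (X^ m) ⟩
  oneₚ +ₚ []               ≈⟨ +ₚ-cong (X^-cong (sym (*-zeroʳ m))) ≋-refl ⟩
  X^ (m * 0) +ₚ []         ∎
qbinom-one m (suc a) = begin
  oneₚ +ₚ Q *ₚ (qbinom m a 0 +ₚ X^ (m * 1) *ₚ b)
    ≈⟨ +ₚ-congˡ oneₚ (*ₚ-congˡ Q (+ₚ-cong (≡⇒≋ (qbinom-zero m a)) (*ₚ-congʳ b (X^-cong (*-identityʳ m))))) ⟩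
  oneₚ +ₚ Q *ₚ (oneₚ +ₚ Q *ₚ b)
    ≈⟨ +ₚ-congˡ oneₚ (*ₚ-congˡ Q (qbinom-one m a)) ⟩
  oneₚ +ₚ Q *ₚ (X^ (m * a) +ₚ b)
    ≈⟨ psolve 3 (λ Q u b → con 1 ⊕ Q ⊗ (u ⊕ b) == Q ⊗ u ⊕ (con 1 ⊕ Q ⊗ b)) ≋-refl Q (X^ (m * a)) b ⟩
  Q *ₚ X^ (m * a) +ₚ (oneₚ +ₚ Q *ₚ b)
    ≈⟨ +ₚ-cong (≋-trans (≋-sym (X^-+ m (m * a))) (X^-cong (sym (*-suc m a))))
               (+ₚ-cong (≡⇒≋ (sym (qbinom-zero m a))) (*ₚ-congʳ b (X^-cong (sym (*-identityʳ m))))) ⟩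
  X^ (m * suc a) +ₚ (qbinom m a 0 +ₚ X^ (m * 1) *ₚ b) ∎
  where
    Q = X^ m
    b = qbinom m a 1

qbinom-pascal′ : ∀ m a b c → b + c ≡ a →
  qbinom m (suc a) (suc b) ≋ X^ (m * c) *ₚ qbinom m a b +ₚ qbinom m a (suc b)
qbinom-pascal′ m a zero c refl = begin
  qbinom m c 0 +ₚ X^ (m * 1) *ₚ qbinom m c 1
    ≈⟨ +ₚ-cong (≡⇒≋ (qbinom-zero m c)) (*ₚ-congʳ (qbinom m c 1) (X^-cong (*-identityʳ m))) ⟩
  oneₚ +ₚ X^ m *ₚ qbinom m c 1
    ≈⟨ qbinom-one m c ⟩
  X^ (m * c) +ₚ qbinom m c 1
    ≈⟨ psolve 2 (λ u b → u ⊕ b == u ⊗ con 1 ⊕ b) ≋-refl (X^ (m * c)) (qbinom m c 1) ⟩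
  X^ (m * c) *ₚ oneₚ +ₚ qbinom m c 1
    ≈⟨ +ₚ-congʳ (qbinom m c 1) (*ₚ-congˡ (X^ (m * c)) (≡⇒≋ (sym (qbinom-zero m c)))) ⟩
  X^ (m * c) *ₚ qbinom m c 0 +ₚ qbinom m c 1 ∎
qbinom-pascal′ m a (suc b) zero refl = begin
  x +ₚ X^ (m * suc (suc b)) *ₚ y
    ≈⟨ +ₚ-congˡ x (*ₚ-congˡ (X^ (m * suc (suc b))) y≋0) ⟩
  x +ₚ X^ (m * suc (suc b)) *ₚ []
    ≈⟨ psolve 2 (λ x w → x ⊕ w ⊗ con 0 == con 1 ⊗ x ⊕ con 0) ≋-refl x (X^ (m * suc (suc b))) ⟩
  oneₚ *ₚ x +ₚ []
    ≈⟨ +ₚ-cong (*ₚ-congʳ x (X^-cong (sym (*-zeroʳ m)))) (≋-sym y≋0) ⟩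
  X^ (m * 0) *ₚ x +ₚ y ∎
  where
    x = qbinom m (suc b + 0) (suc b)
    y = qbinom m (suc b + 0) (suc (suc b))
    y≋0 : y ≋ []
    y≋0 = qbinom-above m (suc b + 0) (suc (suc b)) (s≤s (s≤s (≤-reflexive (+-identityʳ b))))
qbinom-pascal′ m a (suc b) (suc c) refl = begin
  qbinom m (suc a′) (suc b) +ₚ w *ₚ qbinom m (suc a′) (suc (suc b))
    ≈⟨ +ₚ-cong (qbinom-pascal′ m a′ b (suc c) refl)
               (*ₚ-congˡ w (qbinom-pascal′ m a′ (suc b) c (sym (+-suc b c)))) ⟩
  (X^ (m * suc c) *ₚ x +ₚ y) +ₚ w *ₚ (X^ (m * c) *ₚ y +ₚ z)
    ≈⟨ psolve 6 (λ u x y w v z → (u ⊗ x ⊕ y) ⊕ w ⊗ (v ⊗ y ⊕ z) == u ⊗ x ⊕ (w ⊗ v) ⊗ y ⊕ (y ⊕ w ⊗ z))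
         ≋-refl (X^ (m * suc c)) x y w (X^ (m * c)) z ⟩
  X^ (m * suc c) *ₚ x +ₚ (w *ₚ X^ (m * c)) *ₚ y +ₚ (y +ₚ w *ₚ z)
    ≈⟨ +ₚ-congʳ (y +ₚ w *ₚ z) (+ₚ-congˡ (X^ (m * suc c) *ₚ x) (*ₚ-congʳ y exponents)) ⟩
  X^ (m * suc c) *ₚ x +ₚ (X^ (m * suc c) *ₚ X^ (m * suc b)) *ₚ y +ₚ (y +ₚ w *ₚ z)
    ≈⟨ psolve 5 (λ u x v y z → u ⊗ x ⊕ (u ⊗ v) ⊗ y ⊕ z == u ⊗ (x ⊕ v ⊗ y) ⊕ z)
         ≋-refl (X^ (m * suc c)) x (X^ (m * suc b)) y (y +ₚ w *ₚ z) ⟩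
  X^ (m * suc c) *ₚ (x +ₚ X^ (m * suc b) *ₚ y) +ₚ (y +ₚ w *ₚ z) ∎
  where
    a′ = b + suc c
    w = X^ (m * suc (suc b))
    x = qbinom m a′ b
    y = qbinom m a′ (suc b)
    z = qbinom m a′ (suc (suc b))
    exponents : w *ₚ X^ (m * c) ≋ X^ (m * suc c) *ₚ X^ (m * suc b)
    exponents = ≋-trans (≋-sym (X^-+ (m * suc (suc b)) (m * c)))
      (≋-trans (X^-cong (solve 3 (λ m b c → m :* (+-*-Solver.con 2 :+ b) :+ m :* c
                                   := m :* (+-*-Solver.con 1 :+ c) :+ m :* (+-*-Solver.con 1 :+ b)) refl m b c))
               (X^-+ (m * suc c) (m * suc b)))
      where open +-*-Solver

qint-+ : ∀ m p r → qint m (p + r) ≋ qint m p +ₚ X^ (m * p) *ₚ qint m r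
qint-+ m p zero = begin
  qint m (p + 0)                   ≈⟨ ≡⇒≋ (cong (qint m) (+-identityʳ p)) ⟩
  qint m p                         ≈⟨ psolve 2 (λ s u → s == s ⊕ u ⊗ con 0) ≋-refl (qint m p) (X^ (m * p)) ⟩
  qint m p +ₚ X^ (m * p) *ₚ []     ∎
qint-+ m p (suc r) = begin
  qint m (p + suc r)
    ≈⟨ ≡⇒≋ (cong (qint m) (+-suc p r)) ⟩
  qint m (p + r) +ₚ X^ (m * (p + r))
    ≈⟨ +ₚ-cong (qint-+ m p r) (≋-trans (X^-cong (*-distribˡ-+ m p r)) (X^-+ (m * p) (m * r))) ⟩
  (qint m p +ₚ X^ (m * p) *ₚ qint m r) +ₚ X^ (m * p) *ₚ X^ (m * r)
    ≈⟨ psolve 4 (λ s u t v → (s ⊕ u ⊗ t) ⊕ u ⊗ v == s ⊕ u ⊗ (t ⊕ v))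
         ≋-refl (qint m p) (X^ (m * p)) (qint m r) (X^ (m * r)) ⟩
  qint m p +ₚ X^ (m * p) *ₚ (qint m r +ₚ X^ (m * r)) ∎

qbinom-factorial : ∀ m a b c → b + c ≡ a → qbinom m a b *ₚ qfact m b *ₚ qfact m c ≋ qfact m a
qbinom-factorial m a zero c refl = begin
  qbinom m c 0 *ₚ oneₚ *ₚ qfact m c  ≈⟨ *ₚ-congʳ (qfact m c) (*ₚ-congʳ oneₚ (≡⇒≋ (qbinom-zero m c))) ⟩
  oneₚ *ₚ oneₚ *ₚ qfact m c          ≈⟨ psolve 1 (λ f → con 1 ⊗ con 1 ⊗ f == f) ≋-refl (qfact m c) ⟩
  qfact m c                          ∎
qbinom-factorial m a (suc b) zero refl = begin
  qbinom m (suc b + 0) (suc b) *ₚ qfact m (suc b) *ₚ oneₚ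
    ≈⟨ *ₚ-congʳ oneₚ (*ₚ-congʳ (qfact m (suc b)) diag) ⟩
  oneₚ *ₚ qfact m (suc b) *ₚ oneₚ
    ≈⟨ psolve 1 (λ f → con 1 ⊗ f ⊗ con 1 == f) ≋-refl (qfact m (suc b)) ⟩
  qfact m (suc b)
    ≈⟨ ≡⇒≋ (cong (qfact m) (sym (+-identityʳ (suc b)))) ⟩
  qfact m (suc b + 0) ∎
  where
    diag : qbinom m (suc b + 0) (suc b) ≋ oneₚ
    diag = ≋-trans (≡⇒≋ (cong (λ t → qbinom m t (suc b)) (+-identityʳ (suc b)))) (qbinom-diag m (suc b))
qbinom-factorial m a (suc b) (suc c) refl = begin
  (x +ₚ w *ₚ y) *ₚ (fb *ₚ ib) *ₚ (fc *ₚ ic)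
    ≈⟨ psolve 7 (λ x w y fb ib fc ic → (x ⊕ w ⊗ y) ⊗ (fb ⊗ ib) ⊗ (fc ⊗ ic)
                   == x ⊗ fb ⊗ (fc ⊗ ic) ⊗ ib ⊕ (w ⊗ ic) ⊗ (y ⊗ (fb ⊗ ib) ⊗ fc))
         ≋-refl x w y fb ib fc ic ⟩
  x *ₚ fb *ₚ (fc *ₚ ic) *ₚ ib +ₚ (w *ₚ ic) *ₚ (y *ₚ (fb *ₚ ib) *ₚ fc)
    ≈⟨ +ₚ-cong (*ₚ-congʳ ib (qbinom-factorial m a′ b (suc c) refl))
               (*ₚ-congˡ (w *ₚ ic) (qbinom-factorial m a′ (suc b) c (sym (+-suc b c)))) ⟩
  T *ₚ ib +ₚ (w *ₚ ic) *ₚ T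
    ≈⟨ psolve 4 (λ T ib w ic → T ⊗ ib ⊕ (w ⊗ ic) ⊗ T == T ⊗ (ib ⊕ w ⊗ ic)) ≋-refl T ib w ic ⟩
  T *ₚ (ib +ₚ w *ₚ ic)
    ≈⟨ *ₚ-congˡ T (≋-sym (qint-+ m (suc b) (suc c))) ⟩
  T *ₚ qint m (suc a′) ∎
  where
    a′ = b + suc c
    x = qbinom m a′ b
    y = qbinom m a′ (suc b)
    w = X^ (m * suc b)
    fb = qfact m b
    fc = qfact m c
    ib = qint m (suc b)
    ic = qint m (suc c)
    T = qfact m a′

pascalSum : ℕ → ℕ → Poly
pascalSum n k = X^ (n ∸ k) *ₚ qbinom↓ 2 (n ∸ 1) k +ₚ X^ k *ₚ qbinom 2 (n ∸ 1) k

X^-double : ∀ c → X^ (2 * c) ≋ X^ c *ₚ X^ c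
X^-double c = ≋-trans (X^-cong (cong (c +_) (+-identityʳ c))) (X^-+ c c)

pascalSum-suc : ∀ j c →
  (oneₚ +ₚ X^ (suc j + c)) *ₚ (X^ c *ₚ qbinom 2 (j + c) j +ₚ X^ (suc j) *ₚ qbinom 2 (j + c) (suc j))
    ≋ (X^ (suc j) +ₚ X^ c) *ₚ qbinom 2 (suc (j + c)) (suc j)
pascalSum-suc j c = begin
  (oneₚ +ₚ X^ (suc j + c)) *ₚ (v *ₚ x +ₚ u *ₚ y)
    ≈⟨ *ₚ-congʳ (v *ₚ x +ₚ u *ₚ y) (+ₚ-congˡ oneₚ (X^-+ (suc j) c)) ⟩
  (oneₚ +ₚ u *ₚ v) *ₚ (v *ₚ x +ₚ u *ₚ y)
    ≈⟨ psolve 4 (λ u v x y → (con 1 ⊕ u ⊗ v) ⊗ (v ⊗ x ⊕ u ⊗ y)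
                   == u ⊗ (v ⊗ v ⊗ x ⊕ y) ⊕ v ⊗ (x ⊕ u ⊗ u ⊗ y)) ≋-refl u v x y ⟩
  u *ₚ (v *ₚ v *ₚ x +ₚ y) +ₚ v *ₚ (x +ₚ u *ₚ u *ₚ y)
    ≈⟨ +ₚ-cong (*ₚ-congˡ u (+ₚ-congʳ y (*ₚ-congʳ x (≋-sym (X^-double c)))))
               (*ₚ-congˡ v (+ₚ-congˡ x (*ₚ-congʳ y (≋-sym (X^-double (suc j)))))) ⟩
  u *ₚ (X^ (2 * c) *ₚ x +ₚ y) +ₚ v *ₚ B
    ≈⟨ +ₚ-congʳ (v *ₚ B) (*ₚ-congˡ u (≋-sym (qbinom-pascal′ 2 (j + c) j c refl))) ⟩
  u *ₚ B +ₚ v *ₚ B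
    ≈⟨ ≋-sym (*ₚ-distribʳ B u v) ⟩
  (u +ₚ v) *ₚ B ∎
  where
    u = X^ (suc j)
    v = X^ c
    x = qbinom 2 (j + c) j
    y = qbinom 2 (j + c) (suc j)
    B = qbinom 2 (suc (j + c)) (suc j)

pascalSum-zero : ∀ n → (oneₚ +ₚ X^ (suc n)) *ₚ pascalSum (suc n) 0 ≋ (X^ 0 +ₚ X^ (suc n)) *ₚ oneₚ
pascalSum-zero n = begin
  (oneₚ +ₚ X^ (suc n)) *ₚ (X^ (suc n) *ₚ [] +ₚ oneₚ *ₚ qbinom 2 n 0)
    ≈⟨ *ₚ-congˡ (oneₚ +ₚ X^ (suc n)) (+ₚ-congˡ (X^ (suc n) *ₚ []) (*ₚ-congˡ oneₚ (≡⇒≋ (qbinom-zero 2 n)))) ⟩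
  (oneₚ +ₚ X^ (suc n)) *ₚ (X^ (suc n) *ₚ [] +ₚ oneₚ *ₚ oneₚ)
    ≈⟨ psolve 1 (λ w → (con 1 ⊕ w) ⊗ (w ⊗ con 0 ⊕ con 1 ⊗ con 1) == (con 1 ⊕ w) ⊗ con 1) ≋-refl (X^ (suc n)) ⟩
  (oneₚ +ₚ X^ (suc n)) *ₚ oneₚ ∎

pascalSum-identity : ∀ n k → 1 ≤ n → k ≤ n →
  (oneₚ +ₚ X^ n) *ₚ pascalSum n k ≋ (X^ k +ₚ X^ (n ∸ k)) *ₚ qbinom 2 n k
pascalSum-identity (suc n) zero _ _ = pascalSum-zero n
pascalSum-identity (suc n) (suc j) _ (s≤s j≤n) with n ∸ j | m+[n∸m]≡n j≤n
... | c | refl = pascalSum-suc j c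

qint-two : ∀ m → qint m 2 ≋ oneₚ +ₚ X^ m
qint-two m = +ₚ-cong (X^-cong (*-zeroʳ m)) (X^-cong (*-identityʳ m))

bstat-pair : ∀ a b → bstat (a ∷ b ∷ []) ≡ b
bstat-pair a b = trans (+-identityʳ _) (+-identityʳ b)

-- Σ_{σ ∈ C₂} q^{b(σ·α)} = q^{α₂} + q^{α₁}; the rotation swaps the two parts.
cyclicSum-pair : ∀ a b →
  ΣP 2 (λ j → X^ (bstat (rotN (j * (2 / 2)) (a ∷ b ∷ [])))) ≋ X^ b +ₚ X^ a
cyclicSum-pair a b = +ₚ-cong (X^-cong (bstat-pair a b)) (X^-cong (bstat-pair b a))

qfactProd-pair : ∀ m a b → qfactProd m (a ∷ b ∷ []) ≋ qfact m a *ₚ qfact m b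
qfactProd-pair m a b = psolve 2 (λ f g → f ⊗ (g ⊗ con 1) == f ⊗ g) ≋-refl (qfact m a) (qfact m b)

lemma7p5 : (n k : ℕ) → 1 ≤ n → k ≤ n →
    let R = X^ (n ∸ k) *ₚ qbinom↓ 2 (n ∸ 1) k +ₚ X^ k *ₚ qbinom 2 (n ∸ 1) k
    in ((oneₚ +ₚ X^ n) *ₚ R ≈ₚ (X^ k +ₚ X^ (n ∸ k)) *ₚ qbinom 2 n k)
    × IsDeformed n 2 2 (k ∷ (n ∸ k) ∷ []) R
lemma7p5 n k 1≤n k≤n = un part₁ , un part₂
  where
    R : Poly
    R = pascalSum n k

    part₁ : (oneₚ +ₚ X^ n) *ₚ R ≋ (X^ k +ₚ X^ (n ∸ k)) *ₚ qbinom 2 n k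
    part₁ = pascalSum-identity n k 1≤n k≤n

    part₂ : qint (n * 2 / 2) 2 *ₚ R *ₚ qfactProd 2 (k ∷ (n ∸ k) ∷ [])
              ≋ ΣP 2 (λ j → X^ (bstat (rotN (j * (2 / 2)) (k ∷ (n ∸ k) ∷ [])))) *ₚ qfact 2 n
    part₂ = begin
      qint (n * 2 / 2) 2 *ₚ R *ₚ qfactProd 2 (k ∷ (n ∸ k) ∷ [])
        ≈⟨ *ₚ-cong (*ₚ-congʳ R (≋-trans (qint-two (n * 2 / 2)) (+ₚ-congˡ oneₚ (X^-cong (m*n/n≡m n 2)))))
                   (qfactProd-pair 2 k (n ∸ k)) ⟩
      (oneₚ +ₚ X^ n) *ₚ R *ₚ (qfact 2 k *ₚ qfact 2 (n ∸ k))
        ≈⟨ *ₚ-congʳ (qfact 2 k *ₚ qfact 2 (n ∸ k)) part₁ ⟩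
      (X^ k +ₚ X^ (n ∸ k)) *ₚ qbinom 2 n k *ₚ (qfact 2 k *ₚ qfact 2 (n ∸ k))
        ≈⟨ psolve 5 (λ u v b f g → (u ⊕ v) ⊗ b ⊗ (f ⊗ g) == (v ⊕ u) ⊗ (b ⊗ f ⊗ g)) ≋-refl
             (X^ k) (X^ (n ∸ k)) (qbinom 2 n k) (qfact 2 k) (qfact 2 (n ∸ k)) ⟩
      (X^ (n ∸ k) +ₚ X^ k) *ₚ (qbinom 2 n k *ₚ qfact 2 k *ₚ qfact 2 (n ∸ k))
        ≈⟨ *ₚ-cong (≋-sym (cyclicSum-pair k (n ∸ k))) (qbinom-factorial 2 n k (n ∸ k) (m+[n∸m]≡n k≤n)) ⟩
      ΣP 2 (λ j → X^ (bstat (rotN (j * (2 / 2)) (k ∷ (n ∸ k) ∷ [])))) *ₚ qfact 2 n ∎
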